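{- Let $k\ge 3$, let $G=(V,E)$ be an absolute retract of $k$-chromatic graphs and let $c$ be a proper $k$-colouring of $G$. For every colour $i$ and all $u,v\in V_i$ with $u\ne v$ and $d_G(u,v)\ne 3$, there exists $x\in L(u,2,v)$ with $c(x)=i$.
   Context: Graphs are finite, simple (no loops), connected; $d_G$ is shortest-path distance. $V_i=\{v: c(v)=i\}$. $I(u,v)=\{w: d_G(u,v)=d_G(u,w)+d_G(w,v)\}$ and, for $\ell\le d_G(u,v)$, the slice is $L(u,\ell,v)=\{x\in I(u,v): d_G(u,x)=\ell\}$. A $k$-chromatic graph has chromatic number exactly $k$. A subgraph $H$ of $G'$ is isometric if distances between vertices of $H$ agree in $H$ and $G'$, isochromatic if same chromatic number. A retract of $G'$ is the image of $G'$ under an idempotent edge-preserving map. An absolute retract of $k$-chromatic graphs is a $k$-chromatic graph $H$ such that whenever $H$ is an isometric and isochromatic subgraph of a $k$-chromatic graph $G'$, $H$ is a retract of $G'$. -}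

module Defs where

open import Data.Nat using (ℕ; zero; suc; _+_; _<_)
open import Data.Fin using (Fin)
open import Data.Product using (Σ; ∃; _×_; _,_)
open import Relation.Nullary using (¬_)
open import Relation.Binary using (Decidable)
open import Relation.Binary.PropositionalEquality using (_≡_; _≢_)

data Walk {n : ℕ} (Adj : Fin n → Fin n → Set) : Fin n → Fin n → ℕ → Set where
  nil  : ∀ {u} → Walk Adj u u 0
  cons : ∀ {u w v m} → Adj u w → Walk Adj w v m → Walk Adj u v (suc m)

record Graph : Set₁ where
  field
    n         : ℕ
    Adj       : Fin n → Fin n → Set
    adj?      : Decidable Adj
    sym       : ∀ {u v} → Adj u v → Adj v u
    irrefl    : ∀ {u} → ¬ Adj u u
    connected : ∀ u v → ∃ λ m → Walk Adj u v m

open Graph public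

V : Graph → Set
V G = Fin (n G)

Dist : (G : Graph) → V G → V G → ℕ → Set
Dist G u v m = Walk (Adj G) u v m × (∀ m' → Walk (Adj G) u v m' → m Data.Nat.≤ m')

Proper : (G : Graph) (k : ℕ) → (V G → Fin k) → Set
Proper G k c = ∀ {u v} → Adj G u v → c u ≢ c v

Colourable : Graph → ℕ → Set
Colourable G k = Σ (V G → Fin k) (Proper G k)

KChromatic : ℕ → Graph → Set
KChromatic k G = Colourable G k × (∀ j → j < k → ¬ Colourable G j)

IsHom : (G H : Graph) → (V G → V H) → Set
IsHom G H f = ∀ {a b} → Adj G a b → Adj H (f a) (f b)

IsIsometricSubgraph : (H G' : Graph) → (V H → V G') → Set
IsIsometricSubgraph H G' f =
  (∀ {a b} → f a ≡ f b → a ≡ b) ×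
  IsHom H G' f ×
  (∀ a b m → (Dist H a b m → Dist G' (f a) (f b) m) × (Dist G' (f a) (f b) m → Dist H a b m))

-- H (embedded via f) is a retract of G': there is an edge-preserving map
-- r : G' → H fixing H (equivalently, f ∘ r is an idempotent endomorphism of G'
-- whose image is H)
IsRetract : (H G' : Graph) → (V H → V G') → Set
IsRetract H G' f = Σ (V G' → V H) λ r → IsHom G' H r × (∀ a → r (f a) ≡ a)

AbsoluteRetract : ℕ → Graph → Set₁
AbsoluteRetract k H =
  KChromatic k H ×
  (∀ (G' : Graph) (f : V H → V G') →
     KChromatic k G' → IsIsometricSubgraph H G' f → IsRetract H G' f)

InInterval : (G : Graph) → V G → V G → V G → Set
InInterval G u v w = ∃ λ d → ∃ λ d₁ → ∃ λ d₂ →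
  Dist G u v d × Dist G u w d₁ × Dist G w v d₂ × d ≡ d₁ + d₂

InSlice : (G : Graph) → V G → ℕ → V G → V G → Set
InSlice G u ℓ v x = InInterval G u v x × Dist G u x ℓ

module Submission where

-- Distances 0, 1 and 3 are excluded by the hypotheses, and for d(u,v) = 2 take x = v.
-- If d(u,v) = e + 4, extend G to G′ by a k-clique q₀ … q_{k-1}, with u adjacent to
-- every q_j (j ≠ i), and a path q_i p₀ … p_e v. Colouring q_j by j and the path
-- alternately by two colours other than i shows that G′ is still k-chromatic. Mapping
-- the q_j (j ≠ i) to a₁, q_i to a₂ and p₀ … p_e to a₃ … a_{e+3} along a shortest walk
-- u a₁ a₂ … v sends every edge to an edge or a loop, so G is isometric in G′. Hence a
-- retraction r : G′ → G exists, and x = r(q_i) lies at distance 2 from u and e + 2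
-- from v. As r(q₀) … r(q_{k-1}) form a k-clique and all of them except r(q_i) are
-- adjacent to u, whose colour is i, the colour of x is i.

open import Defs hiding (sym)
open import Data.Nat using (ℕ; zero; suc; _+_; _∸_; _≤_; _<_; z≤n; s≤s) renaming (_≟_ to _ℕ≟_)
open import Data.Nat.Properties
  using (≤-refl; ≤-trans; ≤-antisym; ≮⇒≥; anyUpTo?; n≤1+n; +-cancelʳ-≤; +-cancelˡ-≤;
         +-suc; +-identityʳ; m≤n+m; m∸n+n≡m; 1+n≢n; 1+n≰n)
open import Data.Nat.Induction using (<-wellFounded)
open import Data.Fin using (Fin; zero; suc; toℕ; fromℕ<; punchOut)
open import Data.Fin.Properties
  using (_≟_; any?; +↔⊎; toℕ-fromℕ<; toℕ<n; toℕ≤pred[n]; punchInᵢ≢i; punchIn-injective;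
         punchOut-injective; injective⇒≤)
open import Data.Product using (∃; _×_; _,_; proj₁; proj₂)
open import Data.Sum using (_⊎_; inj₁; inj₂; [_,_]′; swap)
open import Data.Empty using (⊥)
open import Data.Sum.Function.Propositional using (_⊎-cong_)
open import Data.Bool using (if_then_else_)
open import Function using (_∘_; _↔_; Inverse)
open import Function.Definitions using (Injective)
open import Function.Properties.Inverse using (↔-refl; ↔-sym; ↔-trans)
open import Induction.WellFounded using (Acc; acc)
open import Relation.Binary.Core using (_=[_]⇒_)
open import Relation.Binary.Definitions using (Symmetric)
open import Relation.Binary.Construct.Closure.Reflexive as Refl using (ReflClosure; [_])
open import Relation.Nullary using (¬_; Dec; yes; no; does; contradiction)
open import Relation.Nullary.Decidable using (_×-dec_; _⊎-dec_; ¬?)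
open import Relation.Binary.PropositionalEquality
  using (_≡_; _≢_; refl; sym; trans; cong; subst; subst₂)

module _ {n : ℕ} {R : Fin n → Fin n → Set} where

  _++ʷ_ : ∀ {a b c p q} → Walk R a b p → Walk R b c q → Walk R a c (p + q)
  nil      ++ʷ w′ = w′
  cons e w ++ʷ w′ = cons e (w ++ʷ w′)

  _∷ʳʷ_ : ∀ {a b c p} → Walk R a b p → R b c → Walk R a c (suc p)
  nil      ∷ʳʷ e′ = cons e′ nil
  cons e w ∷ʳʷ e′ = cons e (w ∷ʳʷ e′)

  reverseʷ : Symmetric R → ∀ {a b p} → Walk R a b p → Walk R b a p
  reverseʷ R-sym nil        = nil
  reverseʷ R-sym (cons e w) = reverseʷ R-sym w ∷ʳʷ R-sym e

  walk? : (∀ a b → Dec (R a b)) → ∀ p a b → Dec (Walk R a b p)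
  walk? R? zero a b with a ≟ b
  ... | yes refl = yes nil
  ... | no  a≢b  = no λ { nil → a≢b refl }
  walk? R? (suc p) a b with any? (λ w → R? a w ×-dec walk? R? p w b)
  ... | yes (w , e , ω) = yes (cons e ω)
  ... | no  ∄w          = no λ { (cons e ω) → ∄w (_ , e , ω) }

  walk-zero : ∀ {a b} → Walk R a b 0 → a ≡ b
  walk-zero nil = refl

  walk-one : ∀ {a b} → Walk R a b 1 → R a b
  walk-one (cons e nil) = e

  vertexAt : ∀ {a b p} → Walk R a b p → ℕ → Fin n
  vertexAt {a} nil        _       = a
  vertexAt {a} (cons _ _) zero    = a
  vertexAt     (cons _ w) (suc s) = vertexAt w s

  vertexAt-zero : ∀ {a b p} (w : Walk R a b p) → vertexAt w 0 ≡ a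
  vertexAt-zero nil        = refl
  vertexAt-zero (cons _ _) = refl

  vertexAt-end : ∀ {a b p} (w : Walk R a b p) → vertexAt w p ≡ b
  vertexAt-end nil        = refl
  vertexAt-end (cons _ w) = vertexAt-end w

  vertexAt-step : ∀ {a b p} (w : Walk R a b p) → ∀ s → s < p →
                  R (vertexAt w s) (vertexAt w (suc s))
  vertexAt-step (cons e w) zero    _         = subst (R _) (sym (vertexAt-zero w)) e
  vertexAt-step (cons e w) (suc s) (s≤s s<p) = vertexAt-step w s s<p

reflClosure-sym : {A : Set} {R : A → A → Set} → Symmetric R → Symmetric (ReflClosure R)
reflClosure-sym R-sym Refl.refl = Refl.refl
reflClosure-sym R-sym [ e ]     = [ R-sym e ]

module _ {m n : ℕ} {R : Fin m → Fin m → Set} {Q : Fin n → Fin n → Set} (f : Fin m → Fin n) where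

  mapʷ : R =[ f ]⇒ Q → ∀ {a b p} → Walk R a b p → Walk Q (f a) (f b) p
  mapʷ f-hom nil        = nil
  mapʷ f-hom (cons e w) = cons (f-hom e) (mapʷ f-hom w)

  contractʷ : R =[ f ]⇒ ReflClosure Q →
              ∀ {a b p} → Walk R a b p → ∃ λ q → q ≤ p × Walk Q (f a) (f b) q
  contractʷ f-weak nil        = 0 , z≤n , nil
  contractʷ f-weak (cons e w) =
    let q , q≤p , w′ = contractʷ f-weak w
        q′ , q′≤1+q , w″ = prepend (f-weak e) w′
    in q′ , ≤-trans q′≤1+q (s≤s q≤p) , w″
    where
    prepend : ∀ {x y z q} → ReflClosure Q x y → Walk Q y z q → ∃ λ q′ → q′ ≤ suc q × Walk Q x z q′
    prepend Refl.refl w′ = _ , n≤1+n _ , w′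
    prepend [ e′ ]    w′ = _ , ≤-refl , cons e′ w′

least : {P : ℕ → Set} → (∀ m → Dec (P m)) → ∀ {m} → P m →
        ∃ λ m′ → P m′ × (∀ t → P t → m′ ≤ t)
least {P} P? {m} = go m (<-wellFounded m)
  where
  go : ∀ m → Acc _<_ m → P m → ∃ λ m′ → P m′ × (∀ t → P t → m′ ≤ t)
  go m (acc below) pm with anyUpTo? P? m
  ... | yes (t , t<m , pt) = go t (below t<m) pt
  ... | no  ∄t             = m , pm , λ t pt → ≮⇒≥ λ t<m → ∄t (t , t<m , pt)

distance : (G : Graph) (u v : V G) → ∃ (Dist G u v)
distance G u v = least (λ m → walk? (adj? G) m u v) (proj₂ (connected G u v))

inSlice : ∀ {G u v x a b} → Dist G u v (a + b) →
          Walk (Adj G) u x a → Walk (Adj G) x v b → InSlice G u a v x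
inSlice {G} {u} {v} {x} {a} {b} d@(_ , shortest) ux xv = (_ , a , b , d , d-ux , d-xv , refl) , d-ux
  where
  d-ux : Dist G u x a
  d-ux = ux , λ m w → +-cancelʳ-≤ b a m (shortest _ (w ++ʷ xv))
  d-xv : Dist G x v b
  d-xv = xv , λ m w → +-cancelˡ-≤ a b m (shortest _ (ux ++ʷ w))

weakRetraction⇒isometric : ∀ {H G′} (f : V H → V G′) (ρ : V G′ → V H) →
                           IsHom H G′ f → Adj G′ =[ ρ ]⇒ ReflClosure (Adj H) →
                           (∀ a → ρ (f a) ≡ a) → IsIsometricSubgraph H G′ f
weakRetraction⇒isometric {H} {G′} f ρ f-hom ρ-weak ρf≡id =
  injective , f-hom , λ a b m → preserve a b m , reflect a b m
  where
  injective : ∀ {a b} → f a ≡ f b → a ≡ b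
  injective {a} {b} eq = trans (sym (ρf≡id a)) (trans (cong ρ eq) (ρf≡id b))

  pull : ∀ {a b p} → Walk (Adj G′) (f a) (f b) p → ∃ λ q → q ≤ p × Walk (Adj H) a b q
  pull {a} {b} w with contractʷ ρ ρ-weak w
  ... | q , q≤p , w′ = q , q≤p , subst₂ (λ x y → Walk (Adj H) x y q) (ρf≡id a) (ρf≡id b) w′

  preserve : ∀ a b m → Dist H a b m → Dist G′ (f a) (f b) m
  preserve a b m (w , shortest) =
    mapʷ f f-hom w , λ m′ w′ → let q , q≤m′ , w″ = pull w′ in ≤-trans (shortest q w″) q≤m′

  reflect : ∀ a b m → Dist G′ (f a) (f b) m → Dist H a b m
  reflect a b m (w , shortest) =
    let q , q≤m , w′ = pull w in
    subst (Walk (Adj H) a b) (≤-antisym q≤m (shortest q (mapw w′))) w′ ,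
    λ m′ w″ → shortest m′ (mapw w″)
    where
    mapw : ∀ {p} → Walk (Adj H) a b p → Walk (Adj G′) (f a) (f b) p
    mapw = mapʷ f f-hom

pullback-colourable : ∀ {G H k} (f : V G → V H) → IsHom G H f → Colourable H k → Colourable G k
pullback-colourable f f-hom (c , c-proper) = c ∘ f , c-proper ∘ f-hom

-- If i were not hit, punching it out would inject Fin n into Fin (n - 1).
injective-endomap-fixes : ∀ {n} (g : Fin n → Fin n) {i : Fin n} →
                          (∀ {j j′} → j ≢ j′ → g j ≢ g j′) → (∀ {j} → j ≢ i → g j ≢ i) →
                          g i ≡ i
injective-endomap-fixes {zero}  g {()}
injective-endomap-fixes {suc m} g {i} g-inj g-avoids with g i ≟ i
... | yes gi≡i = gi≡i
... | no  gi≢i = contradiction (injective⇒≤ h-injective) 1+n≰n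
  where
  misses : ∀ j → i ≢ g j
  misses j with j ≟ i
  ... | yes refl = gi≢i ∘ sym
  ... | no  j≢i  = g-avoids j≢i ∘ sym

  h : Fin (suc m) → Fin m
  h j = punchOut (misses j)

  h-injective : Injective _≡_ _≡_ h
  h-injective {j} {j′} eq with j ≟ j′
  ... | yes j≡j′ = j≡j′
  ... | no  j≢j′ = contradiction (punchOut-injective (misses j) (misses j′) eq) (g-inj j≢j′)

alternate : {A : Set} → A → A → ℕ → A
alternate a b zero    = a
alternate a b (suc t) = alternate b a t

alternate-avoids : ∀ {A : Set} {a b i : A} → a ≢ i → b ≢ i → ∀ t → alternate a b t ≢ i
alternate-avoids a≢i b≢i zero    = a≢i
alternate-avoids a≢i b≢i (suc t) = alternate-avoids b≢i a≢i t

alternate-step : ∀ {A : Set} {a b : A} → a ≢ b → ∀ t → alternate a b t ≢ alternate a b (suc t)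
alternate-step a≢b zero    = a≢b
alternate-step a≢b (suc t) = alternate-step (a≢b ∘ sym) t

module Encoding {S : Set} {N : ℕ} (S↔Fin : S ↔ Fin N) where
  open Inverse S↔Fin public
    using () renaming (to to encode; from to decode; strictlyInverseˡ to encode-decode;
                       strictlyInverseʳ to decode-encode)

  encodedRel : (S → S → Set) → Fin N → Fin N → Set
  encodedRel R x y = R (decode x) (decode y)

  encode-edge : ∀ {R : S → S → Set} {s s′} → R s s′ → encodedRel R (encode s) (encode s′)
  encode-edge {R} {s} {s′} = subst₂ R (sym (decode-encode s)) (sym (decode-encode s′))

  encodedGraph : (R : S → S → Set) → (∀ s s′ → Dec (R s s′)) → Symmetric R → (∀ {s} → ¬ R s s) →
                 (hub : S) → (∀ s → ∃ λ m → Walk (encodedRel R) (encode s) (encode hub) m) → Graph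
  encodedGraph R R? R-sym R-irrefl hub reach = record
    { n = N ; Adj = encodedRel R ; adj? = λ x y → R? (decode x) (decode y)
    ; sym = R-sym ; irrefl = R-irrefl
    ; connected = λ x y → _ , subst₂ (λ a b → Walk (encodedRel R) a b _)
                                     (encode-decode x) (encode-decode y)
                                     (proj₂ (reach (decode x)) ++ʷ reverseʷ R-sym (proj₂ (reach (decode y))))
    }

pattern old a    = inj₁ a
pattern clique j = inj₂ (inj₁ j)
pattern path t   = inj₂ (inj₂ t)

module Gadget (G : Graph) {K : ℕ} (i : Fin K) (u v : V G) (e : ℕ)
              {α β : Fin K} (α≢i : α ≢ i) (β≢i : β ≢ i) (α≢β : α ≢ β) where

  Vertex : Set
  Vertex = V G ⊎ (Fin K ⊎ Fin (suc e))

  Arc : Vertex → Vertex → Set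
  Arc (old a)    (old b)     = Adj G a b
  Arc (old a)    (clique j)  = a ≡ u × j ≢ i
  Arc (old a)    (path t)    = ⊥
  Arc (clique j) (old a)     = ⊥
  Arc (clique j) (clique j′) = j ≢ j′
  Arc (clique j) (path t)    = j ≡ i × toℕ t ≡ 0
  Arc (path t)   (old a)     = toℕ t ≡ e × a ≡ v
  Arc (path t)   (clique j)  = ⊥
  Arc (path t)   (path t′)   = suc (toℕ t) ≡ toℕ t′

  arc? : ∀ s s′ → Dec (Arc s s′)
  arc? (old a)    (old b)     = adj? G a b
  arc? (old a)    (clique j)  = (a ≟ u) ×-dec ¬? (j ≟ i)
  arc? (old a)    (path t)    = no λ ()
  arc? (clique j) (old a)     = no λ ()
  arc? (clique j) (clique j′) = ¬? (j ≟ j′)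
  arc? (clique j) (path t)    = (j ≟ i) ×-dec (toℕ t ℕ≟ 0)
  arc? (path t)   (old a)     = (toℕ t ℕ≟ e) ×-dec (a ≟ v)
  arc? (path t)   (clique j)  = no λ ()
  arc? (path t)   (path t′)   = suc (toℕ t) ℕ≟ toℕ t′

  arc-irrefl : ∀ s → ¬ Arc s s
  arc-irrefl (old a)    = irrefl G
  arc-irrefl (clique j) = λ j≢j → j≢j refl
  arc-irrefl (path t)   = 1+n≢n

  Edge : Vertex → Vertex → Set
  Edge s s′ = Arc s s′ ⊎ Arc s′ s

  Vertex↔Fin : Vertex ↔ Fin (n G + (K + suc e))
  Vertex↔Fin = ↔-sym (↔-trans +↔⊎ (↔-refl ⊎-cong +↔⊎))

  open Encoding Vertex↔Fin

  _∼_ : Fin (n G + (K + suc e)) → Fin (n G + (K + suc e)) → Set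
  _∼_ = encodedRel Edge

  arcᵉ : ∀ {s s′} → Arc s s′ → encode s ∼ encode s′
  arcᵉ {s} {s′} a = encode-edge {Edge} {s} {s′} (inj₁ a)

  arcᵉ˘ : ∀ {s s′} → Arc s′ s → encode s ∼ encode s′
  arcᵉ˘ {s} {s′} a = encode-edge {Edge} {s} {s′} (inj₂ a)

  embed : V G → Fin (n G + (K + suc e))
  embed a = encode (old a)

  embed-hom : Adj G =[ embed ]⇒ _∼_
  embed-hom = arcᵉ

  ascend : ∀ s t → s + toℕ t ≡ e → Walk _∼_ (encode (path t)) (embed v) (suc s)
  ascend zero    t t≡e     = cons (arcᵉ {path t} {old v} (t≡e , refl)) nil
  ascend (suc s) t 1+s+t≡e = cons (arcᵉ {path t} {path t′} (sym (toℕ-fromℕ< 1+t<1+e))) (ascend s t′ s+t′≡e)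
    where
    1+t<1+e : suc (toℕ t) < suc e
    1+t<1+e = s≤s (subst (suc (toℕ t) ≤_) 1+s+t≡e (s≤s (m≤n+m (toℕ t) s)))
    t′ : Fin (suc e)
    t′ = fromℕ< 1+t<1+e
    s+t′≡e : s + toℕ t′ ≡ e
    s+t′≡e = trans (cong (s +_) (toℕ-fromℕ< 1+t<1+e)) (trans (+-suc s (toℕ t)) 1+s+t≡e)

  u⇝clique-i : Walk _∼_ (embed u) (encode (clique i)) 2
  u⇝clique-i = cons (arcᵉ {old u} {clique α} (refl , α≢i)) (cons (arcᵉ {clique α} {clique i} α≢i) nil)

  clique-i⇝v : Walk _∼_ (encode (clique i)) (embed v) (2 + e)
  clique-i⇝v = cons (arcᵉ {clique i} {path zero} (refl , refl)) (ascend e zero (+-identityʳ e))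

  reach-v : ∀ s → ∃ λ m → Walk _∼_ (encode s) (embed v) m
  reach-v (old a) = _ , mapʷ embed embed-hom (proj₂ (connected G a v))
  reach-v (clique j) with j ≟ i
  ... | yes refl = _ , clique-i⇝v
  ... | no  j≢i  = _ , cons (arcᵉ˘ {clique j} {old u} (refl , j≢i)) (proj₂ (reach-v (old u)))
  reach-v (path t) = _ , ascend (e ∸ toℕ t) t (m∸n+n≡m (toℕ≤pred[n] t))

  G′ : Graph
  G′ = encodedGraph Edge (λ s s′ → arc? s s′ ⊎-dec arc? s′ s) swap
                     (λ {s} → [ arc-irrefl s , arc-irrefl s ]′) (old v) reach-v

  module _ (c : V G → Fin K) (c-proper : Proper G K c) (cu : c u ≡ i) (cv : c v ≡ i) where

    colour : Vertex → Fin K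
    colour (old a)    = c a
    colour (clique j) = j
    colour (path t)   = alternate α β (toℕ t)

    arc-proper : ∀ s s′ → Arc s s′ → colour s ≢ colour s′
    arc-proper (old a)    (old b)     ab           = c-proper ab
    arc-proper (old a)    (clique j)  (refl , j≢i) = λ eq → j≢i (trans (sym eq) cu)
    arc-proper (clique j) (clique j′) j≢j′         = j≢j′
    arc-proper (clique j) (path t)    (refl , _)   = alternate-avoids α≢i β≢i (toℕ t) ∘ sym
    arc-proper (path t)   (old a)     (_ , refl)   = λ eq → alternate-avoids α≢i β≢i (toℕ t) (trans eq cv)
    arc-proper (path t)   (path t′)   next         =
      λ eq → alternate-step α≢β (toℕ t) (trans eq (cong (alternate α β) (sym next)))

    G′-kChromatic : KChromatic K G → KChromatic K G′
    G′-kChromatic (_ , no-fewer) =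
      (colour ∘ decode , λ {x} {y} → λ { (inj₁ a) → arc-proper (decode x) (decode y) a
                                        ; (inj₂ a) → arc-proper (decode y) (decode x) a ∘ sym }) ,
      λ j j<K col → no-fewer j j<K (pullback-colourable {G} {G′} embed embed-hom col)

  module _ {a₁ a₂ a₃ : V G} (ua₁ : Adj G u a₁) (a₁a₂ : Adj G a₁ a₂) (a₂a₃ : Adj G a₂ a₃)
           (ω : Walk (Adj G) a₃ v (suc e)) where

    squash : Vertex → V G
    squash (old a)    = a
    squash (clique j) = if does (j ≟ i) then a₂ else a₁
    squash (path t)   = vertexAt ω (toℕ t)

    squash-arc : ∀ s s′ → Arc s s′ → ReflClosure (Adj G) (squash s) (squash s′)
    squash-arc (old a)    (old b)     ab = [ ab ]
    squash-arc (old a)    (clique j)  (refl , j≢i) with j ≟ i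
    ... | yes j≡i = contradiction j≡i j≢i
    ... | no  _   = [ ua₁ ]
    squash-arc (clique j) (clique j′) _ with j ≟ i | j′ ≟ i
    ... | yes _ | yes _ = Refl.refl
    ... | yes _ | no  _ = [ Graph.sym G a₁a₂ ]
    ... | no  _ | yes _ = [ a₁a₂ ]
    ... | no  _ | no  _ = Refl.refl
    squash-arc (clique j) (path t)    (refl , t≡0) with j ≟ i
    ... | yes _   = [ subst (Adj G a₂) (sym (trans (cong (vertexAt ω) t≡0) (vertexAt-zero ω))) a₂a₃ ]
    ... | no  i≢i = contradiction refl i≢i
    squash-arc (path t)   (old a)     (t≡e , refl) =
      [ subst₂ (Adj G) (cong (vertexAt ω) (sym t≡e)) (vertexAt-end ω) (vertexAt-step ω e ≤-refl) ]
    squash-arc (path t)   (path t′)   next =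
      [ subst (Adj G _) (cong (vertexAt ω) next) (vertexAt-step ω (toℕ t) (toℕ<n t)) ]

    embed-isometric : IsIsometricSubgraph G G′ embed
    embed-isometric = weakRetraction⇒isometric {G} {G′} embed (squash ∘ decode) embed-hom squash-edge
                                               (cong squash ∘ decode-encode ∘ old)
      where
      squash-edge : _∼_ =[ squash ∘ decode ]⇒ ReflClosure (Adj G)
      squash-edge {x} {y} (inj₁ a) = squash-arc (decode x) (decode y) a
      squash-edge {x} {y} (inj₂ a) = reflClosure-sym (Graph.sym G) (squash-arc (decode y) (decode x) a)

  retraction-witness : Dist G u v (2 + (2 + e)) → (c : V G → Fin K) → Proper G K c → c u ≡ i →
                       IsRetract G G′ embed → ∃ λ x → InSlice G u 2 v x × c x ≡ i
  retraction-witness d c c-proper cu (r , r-hom , r-fixes) =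
    x , inSlice {G} d u⇝x x⇝v , injective-endomap-fixes cliqueColour distinct avoids
    where
    x : V G
    x = r (encode (clique i))
    u⇝x : Walk (Adj G) u x 2
    u⇝x = subst (λ a → Walk (Adj G) a x 2) (r-fixes u) (mapʷ r r-hom u⇝clique-i)
    x⇝v : Walk (Adj G) x v (2 + e)
    x⇝v = subst (λ b → Walk (Adj G) x b (2 + e)) (r-fixes v) (mapʷ r r-hom clique-i⇝v)
    cliqueColour : Fin K → Fin K
    cliqueColour j = c (r (encode (clique j)))
    distinct : ∀ {j j′} → j ≢ j′ → cliqueColour j ≢ cliqueColour j′
    distinct {j} {j′} j≢j′ = c-proper (r-hom (arcᵉ {clique j} {clique j′} j≢j′))
    avoids : ∀ {j} → j ≢ i → cliqueColour j ≢ i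
    avoids {j} j≢i eq = c-proper (r-hom (arcᵉ {old u} {clique j} (refl , j≢i)))
                                 (trans (cong c (r-fixes u)) (trans cu (sym eq)))

lemma33 : (k : ℕ) → 3 ≤ k → (G : Graph) → AbsoluteRetract k G →
          (c : V G → Fin k) → Proper G k c →
          (i : Fin k) (u v : V G) → c u ≡ i → c v ≡ i → u ≢ v → ¬ Dist G u v 3 →
          ∃ λ x → InSlice G u 2 v x × c x ≡ i
lemma33 (suc (suc (suc _))) (s≤s (s≤s (s≤s _))) G (kχ , retracts) c c-proper i u v cu cv u≢v ¬d₃
  with distance G u v
... | 0 , (ω , _) = contradiction (walk-zero ω) u≢v
... | 1 , (ω , _) = contradiction (trans cu (sym cv)) (c-proper (walk-one ω))
... | 2 , d       = v , inSlice {G} d (proj₁ d) nil , cv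
... | 3 , d       = contradiction d ¬d₃
... | suc (suc (suc (suc e))) , d@(cons ua₁ (cons a₁a₂ (cons a₂a₃ ω)) , _) =
  retraction-witness d c c-proper cu
    (retracts G′ embed (G′-kChromatic c c-proper cu cv kχ) (embed-isometric ua₁ a₁a₂ a₂a₃ ω))
  where
  open Gadget G i u v e (punchInᵢ≢i i zero) (punchInᵢ≢i i (suc zero))
                        ((λ ()) ∘ punchIn-injective i zero (suc zero))
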